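{- For every integer $n\ge2$, $\mathsf{id}_{2n-1}\le\mathsf{PHP}^{2n}_n$ and $\mathsf{id}_{2n}\not\le\mathsf{PHP}^{2n}_n$.
   Context: A number $N\ge1$ is identified with $\{0,\dots,N-1\}$. A (finite) problem $\mathsf{P}$ consists of a nonempty finite set of instances and, for each instance $x$, a nonempty finite set $\mathsf{P}(x)$ of solutions. For finite problems, $\mathsf{P}\le\mathsf{Q}$ if there exist a map $\Phi$ sending each $\mathsf{P}$-instance $x$ to a $\mathsf{Q}$-instance and a (partial) map $\Psi$ on $\mathsf{Q}$-solutions such that $\Psi(y)\in\mathsf{P}(x)$ whenever $y\in\mathsf{Q}(\Phi(x))$. For $m>n\ge2$, $\mathsf{PHP}^m_n$ has as instances all functions $f:m\to n$, with solutions all unordered pairs $\{i,j\}$, $i\ne j$, $f(i)=f(j)$. For $k\ge1$, $\mathsf{id}_k$ has instances $j\in\{1,\dots,k\}$, each instance $j$ having unique solution $j$. -}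

module Defs where

open import Level using (0ℓ)
open import Data.Nat using (ℕ; suc; _<_)
open import Data.Fin using (Fin; toℕ)
open import Data.Product using (Σ; _×_; _,_)
open import Data.Maybe using (Maybe; just)
open import Relation.Binary.PropositionalEquality using (_≡_)
open import Relation.Nullary using (¬_)

record Problem : Set₁ where
  field
    Inst : Set
    Sol  : Set
    _∈P_ : Sol → Inst → Set

open Problem public

_≤ᵖ_ : Problem → Problem → Set
P ≤ᵖ Q =
  Σ (Inst P → Inst Q) λ Φ →
  Σ (Sol Q → Maybe (Sol P)) λ Ψ →
    ∀ (x : Inst P) (y : Sol Q) → _∈P_ Q y (Φ x) →
      Σ (Sol P) λ s → (Ψ y ≡ just s) × _∈P_ P s x

-- Unordered pairs {i,j} with i ≠ j, represented canonically as (i , j) with i < j.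
OrdPair : ℕ → Set
OrdPair m = Σ (Fin m) λ i → Σ (Fin m) λ j → toℕ i < toℕ j

PHP : ℕ → ℕ → Problem
PHP m n = record
  { Inst = Fin m → Fin n
  ; Sol  = OrdPair m
  ; _∈P_ = λ { (i , j , _) f → f i ≡ f j }
  }

-- id_k : instances {1,…,k} (coded as Fin k, j ↦ toℕ j + 1), the unique
-- solution of instance j is j.
idP : ℕ → Problem
idP k = record
  { Inst = Fin k
  ; Sol  = Fin k
  ; _∈P_ = λ s j → s ≡ j
  }

-- The reduction of id_{2n-1} is the round-robin 1-factorisation of K_{2n}.  View the 2n
-- points as ℤ/m together with a point ∞, where m = 2n - 1.  On instance c, send ∞ to 0 and
-- i to the cyclic distance between i and c.  This map is 2-to-1 onto n values, and its
-- collisions are {∞, c} and the pairs {a, b} with a + b ≡ 2c (mod m), so every collision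
-- recovers c, as a or as (a + b)·n mod m.
--
-- In a reduction (Φ, Ψ) of id_k to PHP^m_n, Ψ sends every collision of Φ c to c, so the
-- collision sets of the maps Φ c are pairwise disjoint.  A map m → n has at least m - n
-- collisions, so such a reduction forces k (m - n) ≤ C(m, 2); for k = m = 2n this says
-- 2n² ≤ n (2n - 1).
{-# OPTIONS --safe #-}
module Submission where

open import Defs
open import Data.Nat
  using (ℕ; zero; suc; _≤_; _<_; _+_; _*_; _∸_; _⊓_; z≤n; s≤s; z<s; s<s; s<s⁻¹; _<?_)
open import Data.Nat using (NonZero; >-nonZero)
open import Data.Nat.Properties
open import Data.Nat.DivMod
open import Data.Nat.Combinatorics using (_C_; nC1≡n; nCk+nC[k+1]≡[n+1]C[k+1])
open import Data.Nat.Tactic.RingSolver using (solve-∀)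
open import Data.Bool.Base using (if_then_else_)
open import Data.Fin.Base as Fin using (Fin; zero; suc; toℕ; fromℕ<; punchOut)
open import Data.Fin.Properties as Fin
  using (any?; punchOut-injective; punchOut-cong; toℕ-injective; toℕ-fromℕ<; fromℕ<-injective)
  renaming (_≟_ to _≟ᶠ_)
open import Data.Product using (_×_; _,_)
open import Data.Sum using (_⊎_; inj₁; inj₂)
open import Data.Maybe using (just)
open import Data.Maybe.Properties using (just-injective)
open import Function using (_∘_; _⇔_; mk⇔)
open import Relation.Nullary using (¬_; yes; no; contradiction)
open import Relation.Nullary.Decidable using (does; dec-false; does-⇔)
open import Relation.Unary using (Pred; Decidable)
open import Relation.Binary.Bundles using (Setoid)
import Relation.Binary.Construct.On as On
import Relation.Binary.Reasoning.Setoid as SetoidReasoning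
open import Relation.Binary.PropositionalEquality
open import Algebra.Properties.CommutativeMonoid.Sum +-0-commutativeMonoid
  using (sum-syntax; sum-cong-≗; ∑-distrib-+; ∑-comm)

module Congruence (d : ℕ) .{{_ : NonZero d}} where

  ≈-setoid : Setoid _ _
  ≈-setoid = On.setoid (setoid ℕ) (_% d)

  open Setoid ≈-setoid public using (_≈_) renaming (refl to ≈-refl)
  module ≈-Reasoning = SetoidReasoning ≈-setoid

  %-≈ : ∀ x → x % d ≈ x
  %-≈ x = m%n%n≡m%n x d

  +-≈ : ∀ {x y u v} → x ≈ y → u ≈ v → x + u ≈ y + v
  +-≈ {x} {y} {u} {v} x≈y u≈v = begin
    (x + u) % d                ≡⟨ %-distribˡ-+ x u d ⟩
    (x % d + u % d) % d        ≡⟨ cong₂ (λ a b → (a + b) % d) x≈y u≈v ⟩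
    (y % d + v % d) % d        ≡⟨ %-distribˡ-+ y v d ⟨
    (y + v) % d                ∎
    where open ≡-Reasoning

  *-≈ : ∀ {x y u v} → x ≈ y → u ≈ v → x * u ≈ y * v
  *-≈ {x} {y} {u} {v} x≈y u≈v = begin
    (x * u) % d                ≡⟨ %-distribˡ-* x u d ⟩
    (x % d * (u % d)) % d      ≡⟨ cong₂ (λ a b → (a * b) % d) x≈y u≈v ⟩
    (y % d * (v % d)) % d      ≡⟨ %-distribˡ-* y v d ⟨
    (y * v) % d                ∎
    where open ≡-Reasoning

  d≈0 : d ≈ 0
  d≈0 = trans (n%n≡0 d) (sym (m*n%n≡0 0 d))

  m*d≈0 : ∀ m → m * d ≈ 0
  m*d≈0 m = trans (m*n%n≡0 m d) (sym (m*n%n≡0 0 d))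

  x+m*d≈x : ∀ x m → x + m * d ≈ x
  x+m*d≈x x m = [m+kn]%n≡m%n x m d

  +-cancelʳ-≈ : ∀ {x y} t → x + t ≈ y + t → x ≈ y
  +-cancelʳ-≈ {x} {y} t x+t≈y+t = begin
    x                 ≡⟨ +-identityʳ x ⟨
    x + 0             ≈⟨ +-≈ (≈-refl {x}) t+s≈0 ⟨
    x + (t + s)       ≡⟨ +-assoc x t s ⟨
    x + t + s         ≈⟨ +-≈ x+t≈y+t (≈-refl {s}) ⟩
    y + t + s         ≡⟨ +-assoc y t s ⟩
    y + (t + s)       ≈⟨ +-≈ (≈-refl {y}) t+s≈0 ⟩
    y + 0             ≡⟨ +-identityʳ y ⟩
    y                 ∎
    where
    open ≈-Reasoning
    s = d ∸ t % d
    t+s≈0 : t + s ≈ 0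
    t+s≈0 = begin
      t + s           ≈⟨ +-≈ (%-≈ t) (≈-refl {s}) ⟨
      t % d + s       ≡⟨ m+[n∸m]≡n (m%n≤n t d) ⟩
      d               ≈⟨ d≈0 ⟩
      0               ∎

  ≈⇒≡ : ∀ {x y} → x < d → y < d → x ≈ y → x ≡ y
  ≈⇒≡ {x} {y} x<d y<d x≈y = trans (sym (m<n⇒m%n≡m x<d)) (trans x≈y (m<n⇒m%n≡m y<d))

module RoundRobin (k : ℕ) where

  m n : ℕ
  m = k + suc k
  n = suc k

  instance
    m-nonZero : NonZero m
    m-nonZero = >-nonZero (≤-trans (s≤s z≤n) (m≤n+m (suc k) k))

  open Congruence m

  offset : ℕ → ℕ → ℕ
  offset c i = (i + (m ∸ c)) % m

  cyclicNorm : ℕ → ℕ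
  cyclicNorm x = x ⊓ (m ∸ x)

  offset<m : ∀ c i → offset c i < m
  offset<m c i = m%n<n (i + (m ∸ c)) m

  offset-injective : ∀ c {a b} → a < m → b < m → offset c a ≡ offset c b → a ≡ b
  offset-injective c a<m b<m eq = ≈⇒≡ a<m b<m (+-cancelʳ-≈ (m ∸ c) eq)

  offset-self : ∀ {c} → c ≤ m → offset c c ≡ 0
  offset-self {c} c≤m = trans (cong (_% m) (m+[n∸m]≡n c≤m)) (n%n≡0 m)

  -- n is the inverse of 2 modulo m.
  offset-antipodal : ∀ {c a b} → c < m → offset c a + offset c b ≡ m → (a + b) * n % m ≡ c
  offset-antipodal {c} {a} {b} c<m antipodal =
    ≈⇒≡ (m%n<n _ m) c<m (trans (%-≈ ((a + b) * n)) (+-cancelʳ-≈ t (begin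
    (a + b) * n + t                      ≈⟨ x+m*d≈x _ t ⟨
    (a + b) * n + t + t * m              ≡⟨ double-inverse a b t k ⟩
    n * ((a + t) + (b + t))              ≈⟨ *-≈ (≈-refl {n}) (+-≈ (%-≈ (a + t)) (%-≈ (b + t))) ⟨
    n * (offset c a + offset c b)        ≡⟨ cong (n *_) antipodal ⟩
    n * m                                ≈⟨ m*d≈0 n ⟩
    0                                    ≈⟨ d≈0 ⟨
    m                                    ≡⟨ m+[n∸m]≡n (<⇒≤ c<m) ⟨
    c + t                                ∎)))
    where
    open ≈-Reasoning
    t = m ∸ c
    double-inverse : ∀ a b t k → (a + b) * suc k + t + t * (k + suc k) ≡ suc k * ((a + t) + (b + t))
    double-inverse = solve-∀

  cyclicNorm<n : ∀ x → cyclicNorm x < n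
  cyclicNorm<n x with x <? n
  ... | yes x<n = ≤-<-trans (m⊓n≤m x (m ∸ x)) x<n
  ... | no  x≮n = ≤-<-trans (m⊓n≤n x (m ∸ x)) (s≤s (begin
    m ∸ x      ≤⟨ ∸-monoʳ-≤ m (≮⇒≥ x≮n) ⟩
    m ∸ n      ≡⟨ m+n∸n≡m k n ⟩
    k          ∎))
    where open ≤-Reasoning

  cyclicNorm≡0⇒≡0 : ∀ {x} → x < m → cyclicNorm x ≡ 0 → x ≡ 0
  cyclicNorm≡0⇒≡0 {x} x<m cyclicNorm≡0 with ⊓-sel x (m ∸ x)
  ... | inj₁ cyclicNorm≡x = trans (sym cyclicNorm≡x) cyclicNorm≡0
  ... | inj₂ cyclicNorm≡m∸x =
    contradiction (trans (sym cyclicNorm≡m∸x) cyclicNorm≡0) (>⇒≢ (m<n⇒0<n∸m x<m))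

  cyclicNorm-≡ : ∀ {x y} → x ≤ m → y ≤ m → cyclicNorm x ≡ cyclicNorm y → x ≡ y ⊎ x + y ≡ m
  cyclicNorm-≡ {x} {y} x≤m y≤m eq with ⊓-sel x (m ∸ x) | ⊓-sel y (m ∸ y)
  ... | inj₁ ex | inj₁ ey = inj₁ (trans (sym ex) (trans eq ey))
  ... | inj₁ ex | inj₂ ey =
    inj₂ (trans (cong (_+ y) (trans (sym ex) (trans eq ey))) (m∸n+n≡m y≤m))
  ... | inj₂ ex | inj₁ ey =
    inj₂ (trans (cong (x +_) (trans (sym ey) (trans (sym eq) ex))) (m+[n∸m]≡n x≤m))
  ... | inj₂ ex | inj₂ ey = inj₁ (∸-cancelˡ-≡ x≤m y≤m (trans (sym ex) (trans eq ey)))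

  -- In Fin (suc m) the point ∞ is zero and i ∈ ℤ/m is suc i.
  distance : Fin m → Fin (suc m) → Fin n
  distance c zero    = zero
  distance c (suc i) = fromℕ< (cyclicNorm<n (offset (toℕ c) (toℕ i)))

  centre : OrdPair (suc m) → Fin m
  centre (zero  , suc b , _) = b
  centre (suc a , suc b , _) = ((toℕ a + toℕ b) * n) mod m

  centre-sound : ∀ c a b (a<b : a Fin.< b) → distance c a ≡ distance c b → centre (a , b , a<b) ≡ c
  centre-sound c zero (suc b) _ eq =
    toℕ-injective (offset-injective (toℕ c) (Fin.toℕ<n b) (Fin.toℕ<n c)
                                    (trans offset≡0 (sym offset-c≡0)))
    where
    offset≡0 : offset (toℕ c) (toℕ b) ≡ 0
    offset≡0 =
      cyclicNorm≡0⇒≡0 (offset<m (toℕ c) (toℕ b)) (sym (trans (cong toℕ eq) (toℕ-fromℕ< _)))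
    offset-c≡0 : offset (toℕ c) (toℕ c) ≡ 0
    offset-c≡0 = offset-self (<⇒≤ (Fin.toℕ<n c))
  centre-sound c (suc a) (suc b) a<b eq
    with cyclicNorm-≡ (<⇒≤ (offset<m (toℕ c) (toℕ a))) (<⇒≤ (offset<m (toℕ c) (toℕ b)))
                      (fromℕ<-injective _ _ _ _ eq)
  ... | inj₁ same =
    contradiction (offset-injective (toℕ c) (Fin.toℕ<n a) (Fin.toℕ<n b) same) (<⇒≢ (s<s⁻¹ a<b))
  ... | inj₂ antipodal =
    toℕ-injective (trans (toℕ-fromℕ< _) (offset-antipodal (Fin.toℕ<n c) antipodal))

  idP≤PHP : idP m ≤ᵖ PHP (suc m) n
  idP≤PHP = distance , just ∘ centre ,
    λ c (a , b , a<b) eq → c , cong just (centre-sound c a b a<b eq) , refl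

∑-mono-≤ : ∀ {k} {f g : Fin k → ℕ} → (∀ i → f i ≤ g i) → ∑[ i < k ] f i ≤ ∑[ i < k ] g i
∑-mono-≤ {zero}  f≤g = z≤n
∑-mono-≤ {suc k} f≤g = +-mono-≤ (f≤g zero) (∑-mono-≤ (f≤g ∘ suc))

∑-const : ∀ k c → ∑[ i < k ] c ≡ k * c
∑-const zero    c = refl
∑-const (suc k) c = cong (c +_) (∑-const k c)

count : ∀ {k p} {P : Pred (Fin k) p} → Decidable P → ℕ
count {k} P? = ∑[ i < k ] (if does (P? i) then 1 else 0)

count-cong : ∀ {k p q} {P : Pred (Fin k) p} {Q : Pred (Fin k) q}
             (P? : Decidable P) (Q? : Decidable Q) → (∀ i → P i ⇔ Q i) → count P? ≡ count Q?
count-cong P? Q? P⇔Q = sum-cong-≗ λ i → cong (λ b → if b then 1 else 0) (does-⇔ (P⇔Q i) (P? i) (Q? i))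

count-none : ∀ {k p} {P : Pred (Fin k) p} (P? : Decidable P) → (∀ i → ¬ P i) → count P? ≡ 0
count-none {k} P? ¬P = begin
  ∑[ i < k ] (if does (P? i) then 1 else 0)
    ≡⟨ sum-cong-≗ (λ i → cong (λ b → if b then 1 else 0) (dec-false (P? i) (¬P i))) ⟩
  ∑[ i < k ] 0
    ≡⟨ ∑-const k 0 ⟩
  k * 0
    ≡⟨ *-zeroʳ k ⟩
  0 ∎
  where open ≡-Reasoning

count-pos : ∀ {k p} {P : Pred (Fin k) p} (P? : Decidable P) {i} → P i → 0 < count P?
count-pos P? {zero} Pi with P? zero
... | yes _   = s≤s z≤n
... | no  ¬Pi = contradiction Pi ¬Pi
count-pos P? {suc i} Pi = ≤-trans (count-pos (P? ∘ suc) Pi) (m≤n+m _ _)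

count≤1 : ∀ {k p} {P : Pred (Fin k) p} (P? : Decidable P) →
          (∀ {i j} → P i → P j → i ≡ j) → count P? ≤ 1
count≤1 {zero}  P? unique = z≤n
count≤1 {suc k} P? unique with P? zero
... | yes P0 = s≤s (≤-reflexive (count-none (P? ∘ suc) (λ i Pi → Fin.0≢1+n (unique P0 Pi))))
... | no  _  = count≤1 (P? ∘ suc) (λ Pi Pj → Fin.suc-injective (unique Pi Pj))

headCollisions : ∀ {m n} → (Fin (suc m) → Fin n) → ℕ
headCollisions f = count (λ j → f zero ≟ᶠ f (suc j))

collisions : ∀ {m n} → (Fin m → Fin n) → ℕ
collisions {zero}  f = 0
collisions {suc m} f = headCollisions f + collisions (f ∘ suc)

collisions-cong : ∀ {m n n′} (f : Fin m → Fin n) (g : Fin m → Fin n′) →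
                  (∀ a b → f a ≡ f b ⇔ g a ≡ g b) → collisions f ≡ collisions g
collisions-cong {zero}  f g f⇔g = refl
collisions-cong {suc m} f g f⇔g = cong₂ _+_
  (count-cong (λ j → f zero ≟ᶠ f (suc j)) (λ j → g zero ≟ᶠ g (suc j)) (f⇔g zero ∘ suc))
  (collisions-cong (f ∘ suc) (g ∘ suc) (λ a b → f⇔g (suc a) (suc b)))

-- When f 0 collides with no later point, the rest of f avoids the value f 0 and so maps
-- into n - 1 values.
m≤collisions+n : ∀ {m n} (f : Fin m → Fin n) → m ≤ collisions f + n
m≤collisions+n {zero}          f = z≤n
m≤collisions+n {suc m} {zero}  f with () ← f zero
m≤collisions+n {suc m} {suc n} f with any? (λ j → f zero ≟ᶠ f (suc j))
... | yes (j , f0≡fj) = begin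
  1 + m
    ≤⟨ +-mono-≤ (count-pos (λ j → f zero ≟ᶠ f (suc j)) f0≡fj) (m≤collisions+n (f ∘ suc)) ⟩
  headCollisions f + (collisions (f ∘ suc) + suc n)
    ≡⟨ +-assoc (headCollisions f) _ _ ⟨
  headCollisions f + collisions (f ∘ suc) + suc n ∎
  where open ≤-Reasoning
... | no f0-fresh = begin
  1 + m
    ≤⟨ s≤s (m≤collisions+n g) ⟩
  1 + (collisions g + n)
    ≡⟨ cong (λ c → 1 + (c + n)) (collisions-cong g (f ∘ suc) g⇔f) ⟩
  1 + (collisions (f ∘ suc) + n)
    ≡⟨ +-suc _ n ⟨
  collisions (f ∘ suc) + suc n
    ≡⟨ cong (λ c → c + collisions (f ∘ suc) + suc n) (count-none (λ j → f zero ≟ᶠ f (suc j)) f0≢f) ⟨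
  headCollisions f + collisions (f ∘ suc) + suc n ∎
  where
  open ≤-Reasoning
  f0≢f : ∀ j → f zero ≢ f (suc j)
  f0≢f j f0≡fj = f0-fresh (j , f0≡fj)
  g : Fin m → Fin n
  g j = punchOut (f0≢f j)
  g⇔f : ∀ a b → g a ≡ g b ⇔ f (suc a) ≡ f (suc b)
  g⇔f a b = mk⇔ (punchOut-injective (f0≢f a) (f0≢f b)) (punchOut-cong (f zero))

DisjointCollisions : ∀ {k m n} → (Fin k → Fin m → Fin n) → Set
DisjointCollisions F = ∀ {i j a b} → a Fin.< b → F i a ≡ F i b → F j a ≡ F j b → i ≡ j

[1+m]C2≡m+mC2 : ∀ m → suc m C 2 ≡ m + m C 2
[1+m]C2≡m+mC2 m = begin
  suc m C 2         ≡⟨ nCk+nC[k+1]≡[n+1]C[k+1] m 1 ⟨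
  m C 1 + m C 2     ≡⟨ cong (_+ m C 2) (nC1≡n m) ⟩
  m + m C 2         ∎
  where open ≡-Reasoning

∑collisions≤C2 : ∀ {k m n} (F : Fin k → Fin m → Fin n) → DisjointCollisions F →
                 ∑[ i < k ] collisions (F i) ≤ m C 2
∑collisions≤C2 {k} {zero}  F disjoint = ≤-reflexive (trans (∑-const k 0) (*-zeroʳ k))
∑collisions≤C2 {k} {suc m} F disjoint = begin
  ∑[ i < k ] (headCollisions (F i) + collisions (F i ∘ suc))
    ≡⟨ ∑-distrib-+ (λ i → headCollisions (F i)) (λ i → collisions (F i ∘ suc)) ⟩
  ∑[ i < k ] headCollisions (F i) + ∑[ i < k ] collisions (F i ∘ suc)
    ≡⟨ cong (_+ ∑[ i < k ] collisions (F i ∘ suc))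
            (∑-comm (λ i b → if does (F i zero ≟ᶠ F i (suc b)) then 1 else 0)) ⟩
  ∑[ b < m ] count (λ i → F i zero ≟ᶠ F i (suc b)) + ∑[ i < k ] collisions (F i ∘ suc)
    ≤⟨ +-mono-≤ (∑-mono-≤ λ b → count≤1 (λ i → F i zero ≟ᶠ F i (suc b)) (disjoint z<s))
                (∑collisions≤C2 (λ i → F i ∘ suc) (disjoint ∘ s<s)) ⟩
  ∑[ b < m ] 1 + m C 2
    ≡⟨ cong (_+ m C 2) (trans (∑-const m 1) (*-identityʳ m)) ⟩
  m + m C 2
    ≡⟨ [1+m]C2≡m+mC2 m ⟨
  suc m C 2
    ∎
  where open ≤-Reasoning

idP≤PHP⇒k*[m∸n]≤mC2 : ∀ {k m n} → idP k ≤ᵖ PHP m n → k * (m ∸ n) ≤ m C 2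
idP≤PHP⇒k*[m∸n]≤mC2 {k} {m} {n} (Φ , Ψ , Ψ-sound) = begin
  k * (m ∸ n)
    ≡⟨ ∑-const k (m ∸ n) ⟨
  ∑[ i < k ] (m ∸ n)
    ≤⟨ ∑-mono-≤ (λ i → m≤n+o⇒m∸n≤o m n (subst (m ≤_) (+-comm _ n) (m≤collisions+n (Φ i)))) ⟩
  ∑[ i < k ] collisions (Φ i)
    ≤⟨ ∑collisions≤C2 Φ disjoint ⟩
  m C 2 ∎
  where
  open ≤-Reasoning
  disjoint : DisjointCollisions Φ
  disjoint {a = a} {b} a<b Φia≡Φib Φja≡Φjb
    with Ψ-sound _ (a , b , a<b) Φia≡Φib | Ψ-sound _ (a , b , a<b) Φja≡Φjb
  ... | _ , Ψab≡i , refl | _ , Ψab≡j , refl = just-injective (trans (sym Ψab≡i) Ψab≡j)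

mC2+mC2+m≡m*m : ∀ m → m C 2 + m C 2 + m ≡ m * m
mC2+mC2+m≡m*m zero    = refl
mC2+mC2+m≡m*m (suc m) = begin
  suc m C 2 + suc m C 2 + suc m            ≡⟨ cong (λ c → c + c + suc m) ([1+m]C2≡m+mC2 m) ⟩
  (m + m C 2) + (m + m C 2) + suc m        ≡⟨ regroup m (m C 2) ⟩
  (m C 2 + m C 2 + m) + suc (m + m)        ≡⟨ cong (_+ suc (m + m)) (mC2+mC2+m≡m*m m) ⟩
  m * m + suc (m + m)                      ≡⟨ square-suc m ⟩
  suc m * suc m                            ∎
  where
  open ≡-Reasoning
  regroup : ∀ m c → (m + c) + (m + c) + suc m ≡ (c + c + m) + suc (m + m)
  regroup = solve-∀
  square-suc : ∀ m → m * m + suc (m + m) ≡ suc m * suc m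
  square-suc = solve-∀

[n+n]C2<[n+n]*n : ∀ {n} → 0 < n → (n + n) C 2 < (n + n) * n
[n+n]C2<[n+n]*n {n} 0<n = ≰⇒> λ [n+n]*n≤C → <-irrefl refl (begin-strict
  N * N            ≡⟨ *-distribˡ-+ N n n ⟩
  N * n + N * n    ≤⟨ +-mono-≤ [n+n]*n≤C [n+n]*n≤C ⟩
  N C 2 + N C 2    <⟨ m<m+n (N C 2 + N C 2) (≤-trans 0<n (m≤m+n n n)) ⟩
  N C 2 + N C 2 + N ≡⟨ mC2+mC2+m≡m*m N ⟩
  N * N            ∎)
  where
  open ≤-Reasoning
  N = n + n

¬idP[n+n]≤PHP[n+n,n] : ∀ {n} → 0 < n → ¬ (idP (n + n) ≤ᵖ PHP (n + n) n)
¬idP[n+n]≤PHP[n+n,n] {n} 0<n reduction = <⇒≱ ([n+n]C2<[n+n]*n 0<n)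
  (subst (λ c → (n + n) * c ≤ (n + n) C 2) (m+n∸n≡m n n) (idP≤PHP⇒k*[m∸n]≤mC2 reduction))

proposition2p16 : ∀ (n : ℕ) → 2 ≤ n →
    (idP ((n + n) ∸ 1) ≤ᵖ PHP (n + n) n) × ¬ (idP (n + n) ≤ᵖ PHP (n + n) n)
proposition2p16 (suc k) _ = RoundRobin.idP≤PHP k , ¬idP[n+n]≤PHP[n+n,n] z<s
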